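{- Let $m\ge2$, $n\ge1$ and let $\varphi^{(n)}$ be as defined in the context. If $\varphi^{(n)}(v_1,\dots,v_n)=(\widetilde{\widetilde v}_1,\dots,\widetilde{\widetilde v}_n)$, then for each $i\in\{1,\dots,n\}$, $$v_i=\Bigl(\widetilde{\widetilde v}_i-\sum_{j=1}^{i-1}\widetilde{\widetilde v}_j\Bigr)\bmod m.$$ In particular $\varphi^{(n)}$ is a bijection with inverse given by this formula.
   Context: Fix $m\ge2$. Define maps $\varphi^{(n)}:\{0,\dots,m-1\}^n\to\{0,\dots,m-1\}^n$ recursively: $\varphi^{(1)}$ is the identity, and for $n\ge2$, $\varphi^{(n)}(v_1,v_2,\dots,v_n)=\bigl(v_1,\ \varphi^{(n-1)}((v_1+v_2)\bmod m,\dots,(v_1+v_n)\bmod m)\bigr)$. -}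

module Defs where

open import Data.Nat using (ℕ; zero; suc; _+_; NonZero)
open import Data.Nat.DivMod using (_mod_)
open import Data.Fin using (Fin; toℕ; _<?_)
open import Data.Vec using (Vec; []; _∷_; map; lookup)
open import Data.List using (List; filter) renaming (map to mapL)
open import Data.Nat.ListAction using (sum)
open import Data.List using () renaming (allFin to allFinL)

_⊕[_]_ : ∀ {m} → Fin m → (m' : ℕ) → .{{NonZero m}} → Fin m → Fin m
_⊕[_]_ {m} a _ b = (toℕ a + toℕ b) mod m

φ : (m : ℕ) → .{{NonZero m}} → (n : ℕ) → Vec (Fin m) n → Vec (Fin m) n
φ m zero [] = []
φ m (suc n) (v₁ ∷ vs) = v₁ ∷ φ m n (map (λ x → v₁ ⊕[ m ] x) vs)

-- Σ_{j<i} w_j  (as a natural number; indices 0-based, j ranges over Fin n with j < i)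
prefixSum : ∀ {m n} → Vec (Fin m) n → Fin n → ℕ
prefixSum {m} {n} w i = sum (mapL (λ j → toℕ (lookup w j)) (filter (λ j → j <? i) (allFinL n)))

-- φ adds its first input to all later ones and recurses, so its i-th output is v_i
-- plus all earlier outputs, taken mod m; subtracting that prefix sum in ℤ and
-- reducing mod m recovers v_i. This formula makes φ injective, and φ is surjective
-- because each step v ↦ v₁ + v is invertible mod m.
module Submission where

open import Defs
open import Data.Nat using (ℕ; _≤_; NonZero)
open import Data.Integer using (+_; _-_)
open import Data.Integer.DivMod using (_%ℕ_)
open import Data.Fin using (Fin; toℕ)
open import Data.Vec using (Vec; lookup)
open import Data.Product using (_×_)
open import Relation.Binary.PropositionalEquality using (_≡_)
open import Function.Definitions using (Bijective; Injective; StrictlySurjective)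

open import Data.Nat as ℕ using (zero; suc; _<_; _∸_)
open import Data.Nat.Properties as ℕ using (+-comm; m+[n∸m]≡n; <⇒≤; ⊔-pres-<m)
open import Data.Nat.DivMod using (_%_; _/_; _mod_; m≡m%n+[m/n]*n; m%n<n; m<n⇒m%n≡m; m%n%n≡m%n; %-distribˡ-+; [m+n]%n≡m%n)
open import Data.Nat.Divisibility using (divides; _∣_; >⇒∤)
open import Data.Integer.DivMod using (_/ℕ_; a≡a%ℕn+[a/ℕn]*n; n%ℕd<d)
open import Data.Integer.Properties using (+-injective; +-inverseʳ; +-identityˡ; +-identityʳ; abs-*; m-n≡m⊖n; ∣m⊝n∣≤m⊔n; ∣i∣≡0⇒i≡0; i-j≡0⇒i≡j; pos-+; pos-*)
open import Data.Integer.Tactic.RingSolver using (solve-∀)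
open import Data.Fin using (_<?_) renaming (zero to fzero; suc to fsuc)
open import Data.Fin.Properties using (toℕ-injective; toℕ<n; toℕ-fromℕ<)
open import Data.Vec as Vec using ([]; _∷_; map)
open import Data.Vec.Properties using (lookup-map; map-∘; map-cong; map-id; tabulate∘lookup; tabulate-cong)
open import Data.List as List using (filter; tabulate)
open import Data.List.Properties as List using (filter-none; filter-≐; map-tabulate)
import Data.List.Relation.Unary.All as All
open import Data.Nat.ListAction using (sum)
open import Data.Product using (_,_)
open import Function.Base using (_∘_; id)
open import Function.Consequences.Propositional using (strictlySurjective⇒surjective)
open import Relation.Nullary using (contradiction; does)
open import Algebra.Properties.CommutativeSemigroup ℕ.+-commutativeSemigroup using (xy∙z≈y∙xz; x∙yz≈y∙xz)
open import Data.Bool using (true; false)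
open import Relation.Unary using (Pred; Decidable)
open import Relation.Binary.PropositionalEquality using (refl; sym; trans; cong; cong₂; module ≡-Reasoning)

n∣m⇒m<n⇒m≡0 : ∀ {m n} → n ∣ m → m < n → m ≡ 0
n∣m⇒m<n⇒m≡0 {zero}  _   _   = refl
n∣m⇒m<n⇒m≡0 {suc _} n∣m m<n = contradiction n∣m (>⇒∤ m<n)

module _ where
  open import Data.Integer using (0ℤ; _+_; _*_; -_; ∣_∣)

  -- Two representations r + k d and r′ + q d of i with r, r′ < d show that d divides
  -- ∣ r - r′ ∣ < d.
  %ℕ-unique : ∀ {d r} .{{_ : NonZero d}} i k → i ≡ + r + k * + d → r < d → i %ℕ d ≡ r
  %ℕ-unique {d} {r} i k i≡r+kd r<d = sym (+-injective (i-j≡0⇒i≡j (+ r) (+ r′) r-r′≡0))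
    where
    r′ = i %ℕ d
    q = i /ℕ d

    r-r′≡[q-k]d : + r - + r′ ≡ (q - k) * + d
    r-r′≡[q-k]d = begin
      + r - + r′                                           ≡⟨ regroup (+ r) (+ r′) q k (+ d) ⟩
      ((+ r + k * + d) - (+ r′ + q * + d)) + (q - k) * + d ≡⟨ cong₂ (λ x y → (x - y) + (q - k) * + d) (sym i≡r+kd) (sym (a≡a%ℕn+[a/ℕn]*n i d)) ⟩
      (i - i) + (q - k) * + d                              ≡⟨ cong (_+ (q - k) * + d) (+-inverseʳ i) ⟩
      0ℤ + (q - k) * + d                                   ≡⟨ +-identityˡ _ ⟩
      (q - k) * + d                                        ∎
      where
      open ≡-Reasoning
      regroup : ∀ r r′ q k d → r - r′ ≡ ((r + k * d) - (r′ + q * d)) + (q - k) * d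
      regroup = solve-∀

    d∣∣r-r′∣ : d ∣ ∣ + r - + r′ ∣
    d∣∣r-r′∣ = divides ∣ q - k ∣ (trans (cong ∣_∣ r-r′≡[q-k]d) (abs-* (q - k) (+ d)))

    ∣r-r′∣<d : ∣ + r - + r′ ∣ < d
    ∣r-r′∣<d = ℕ.≤-<-trans (ℕ.≤-reflexive (cong ∣_∣ (m-n≡m⊖n r r′)))
                 (ℕ.≤-<-trans (∣m⊝n∣≤m⊔n r r′) (⊔-pres-<m r<d (n%ℕd<d i d)))

    r-r′≡0 : + r - + r′ ≡ 0ℤ
    r-r′≡0 = ∣i∣≡0⇒i≡0 (n∣m⇒m<n⇒m≡0 d∣∣r-r′∣ ∣r-r′∣<d)

  [[m+n]%d-n]%ℕd≡m : ∀ m n d .{{_ : NonZero d}} → m < d → (+ ((m ℕ.+ n) % d) - + n) %ℕ d ≡ m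
  [[m+n]%d-n]%ℕd≡m m n d m<d = %ℕ-unique _ (- + q) w-n≡m-qd m<d
    where
    open ≡-Reasoning
    w = (m ℕ.+ n) % d
    q = (m ℕ.+ n) / d

    w+qd≡m+n : + w + + q * + d ≡ + m + + n
    w+qd≡m+n = begin
      + w + + q * + d     ≡⟨ cong (_+_ (+ w)) (pos-* q d) ⟨
      + w + + (q ℕ.* d)   ≡⟨ pos-+ w (q ℕ.* d) ⟨
      + (w ℕ.+ q ℕ.* d)   ≡⟨ cong +_ (m≡m%n+[m/n]*n (m ℕ.+ n) d) ⟨
      + (m ℕ.+ n)         ≡⟨ pos-+ m n ⟩
      + m + + n           ∎

    w-n≡m-qd : + w - + n ≡ + m + (- + q) * + d
    w-n≡m-qd = begin
      + w - + n                                               ≡⟨ regroup (+ w) (+ n) (+ m) (+ q) (+ d) ⟩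
      + m + (- + q) * + d + ((+ w + + q * + d) - (+ m + + n)) ≡⟨ cong (λ x → + m + (- + q) * + d + (x - (+ m + + n))) w+qd≡m+n ⟩
      + m + (- + q) * + d + ((+ m + + n) - (+ m + + n))       ≡⟨ cong (_+_ (+ m + (- + q) * + d)) (+-inverseʳ (+ m + + n)) ⟩
      + m + (- + q) * + d + 0ℤ                                ≡⟨ +-identityʳ _ ⟩
      + m + (- + q) * + d                                     ∎
      where
      regroup : ∀ w n m q d → w - n ≡ m + (- q) * d + ((w + q * d) - (m + n))
      regroup = solve-∀

open import Data.Nat using (_+_)

[m%d+n]%d≡[m+n]%d : ∀ m n d .{{_ : NonZero d}} → (m % d + n) % d ≡ (m + n) % d
[m%d+n]%d≡[m+n]%d m n d = begin
  (m % d + n) % d           ≡⟨ %-distribˡ-+ (m % d) n d ⟩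
  (m % d % d + n % d) % d   ≡⟨ cong (λ x → (x + n % d) % d) (m%n%n≡m%n m d) ⟩
  (m % d + n % d) % d       ≡⟨ %-distribˡ-+ m n d ⟨
  (m + n) % d               ∎
  where open ≡-Reasoning

[m+n%d]%d≡[m+n]%d : ∀ m n d .{{_ : NonZero d}} → (m + n % d) % d ≡ (m + n) % d
[m+n%d]%d≡[m+n]%d m n d = begin
  (m + n % d) % d ≡⟨ cong (_% d) (+-comm m (n % d)) ⟩
  (n % d + m) % d ≡⟨ [m%d+n]%d≡[m+n]%d n m d ⟩
  (n + m) % d     ≡⟨ cong (_% d) (+-comm n m) ⟩
  (m + n) % d     ∎
  where open ≡-Reasoning


filter-map : ∀ {a b p} {A : Set a} {B : Set b} {P : Pred B p} (P? : Decidable P) (f : A → B) xs →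
             filter P? (List.map f xs) ≡ List.map f (filter (P? ∘ f) xs)
filter-map P? f List.[] = refl
filter-map P? f (x List.∷ xs) with does (P? (f x))
... | true  = cong (f x List.∷_) (filter-map P? f xs)
... | false = filter-map P? f xs

prefixSum-zero : ∀ {m n} (x : Fin m) (w : Vec (Fin m) n) → prefixSum (x ∷ w) fzero ≡ 0
prefixSum-zero {n = n} x w =
  cong (sum ∘ List.map (toℕ ∘ lookup (x ∷ w))) (filter-none (_<? fzero {n}) (All.universal (λ _ ()) (List.allFin (suc n))))

prefixSum-suc : ∀ {m n} (x : Fin m) (w : Vec (Fin m) n) i → prefixSum (x ∷ w) (fsuc i) ≡ toℕ x + prefixSum w i
prefixSum-suc {n = n} x w i = cong (_+_ (toℕ x)) (begin
  sum (List.map g (filter (_<? fsuc i) (tabulate fsuc)))          ≡⟨ cong (sum ∘ List.map g ∘ filter (_<? fsuc i)) (map-tabulate id fsuc) ⟨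
  sum (List.map g (filter (_<? fsuc i) (List.map fsuc js)))       ≡⟨ cong (sum ∘ List.map g) (filter-map (_<? fsuc i) fsuc js) ⟩
  sum (List.map g (List.map fsuc (filter ((_<? fsuc i) ∘ fsuc) js))) ≡⟨ cong (sum ∘ List.map g ∘ List.map fsuc) (filter-≐ _ (_<? i) (ℕ.s<s⁻¹ , ℕ.s<s) js) ⟩
  sum (List.map g (List.map fsuc (filter (_<? i) js)))            ≡⟨ cong sum (List.map-∘ (filter (_<? i) js)) ⟨
  prefixSum w i                                                   ∎)
  where
  open ≡-Reasoning
  js = List.allFin n
  g : Fin (suc n) → ℕ
  g = toℕ ∘ lookup (x ∷ w)

toℕ-⊕ : ∀ {m} .{{_ : NonZero m}} (a b : Fin m) → toℕ (a ⊕[ m ] b) ≡ (toℕ a + toℕ b) % m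
toℕ-⊕ {m} a b = toℕ-fromℕ< (m%n<n (toℕ a + toℕ b) m)

lookup-φ : ∀ m .{{_ : NonZero m}} n (v : Vec (Fin m) n) i →
           toℕ (lookup (φ m n v) i) ≡ (toℕ (lookup v i) + prefixSum (φ m n v) i) % m
lookup-φ m (suc n) (v₁ ∷ vs) fzero = begin
  toℕ v₁                                    ≡⟨ m<n⇒m%n≡m (toℕ<n v₁) ⟨
  toℕ v₁ % m                                ≡⟨ cong (_% m) (ℕ.+-identityʳ (toℕ v₁)) ⟨
  (toℕ v₁ + 0) % m                          ≡⟨ cong (λ s → (toℕ v₁ + s) % m) (prefixSum-zero v₁ (φ m n _)) ⟨
  (toℕ v₁ + prefixSum (φ m (suc n) (v₁ ∷ vs)) fzero) % m ∎
  where open ≡-Reasoning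
lookup-φ m (suc n) (v₁ ∷ vs) (fsuc j) = begin
  toℕ (lookup w j)                                    ≡⟨ lookup-φ m n u j ⟩
  (toℕ (lookup u j) + prefixSum w j) % m              ≡⟨ cong (λ x → (toℕ x + prefixSum w j) % m) (lookup-map j (v₁ ⊕[ m ]_) vs) ⟩
  (toℕ (v₁ ⊕[ m ] vⱼ) + prefixSum w j) % m            ≡⟨ cong (λ x → (x + prefixSum w j) % m) (toℕ-⊕ v₁ vⱼ) ⟩
  ((toℕ v₁ + toℕ vⱼ) % m + prefixSum w j) % m         ≡⟨ [m%d+n]%d≡[m+n]%d (toℕ v₁ + toℕ vⱼ) (prefixSum w j) m ⟩
  (toℕ v₁ + toℕ vⱼ + prefixSum w j) % m               ≡⟨ cong (_% m) (xy∙z≈y∙xz (toℕ v₁) (toℕ vⱼ) (prefixSum w j)) ⟩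
  (toℕ vⱼ + (toℕ v₁ + prefixSum w j)) % m             ≡⟨ cong (λ s → (toℕ vⱼ + s) % m) (prefixSum-suc v₁ w j) ⟨
  (toℕ vⱼ + prefixSum (v₁ ∷ w) (fsuc j)) % m          ∎
  where
  open ≡-Reasoning
  u = map (v₁ ⊕[ m ]_) vs
  w = φ m n u
  vⱼ = lookup vs j

lookup-from-φ : ∀ m .{{_ : NonZero m}} n (v : Vec (Fin m) n) i →
                toℕ (lookup v i) ≡ (+ toℕ (lookup (φ m n v) i) - + prefixSum (φ m n v) i) %ℕ m
lookup-from-φ m n v i = begin
  toℕ (lookup v i)                                  ≡⟨ [[m+n]%d-n]%ℕd≡m (toℕ (lookup v i)) s m (toℕ<n (lookup v i)) ⟨
  (+ ((toℕ (lookup v i) + s) % m) - + s) %ℕ m        ≡⟨ cong (λ x → (+ x - + s) %ℕ m) (lookup-φ m n v i) ⟨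
  (+ toℕ (lookup (φ m n v) i) - + s) %ℕ m           ∎
  where
  open ≡-Reasoning
  s = prefixSum (φ m n v) i

φ-injective : ∀ m .{{_ : NonZero m}} n → Injective _≡_ _≡_ (φ m n)
φ-injective m n {v} {v′} φv≡φv′ = begin
  v                        ≡⟨ tabulate∘lookup v ⟨
  Vec.tabulate (lookup v)  ≡⟨ tabulate-cong (λ i → toℕ-injective (same-entries i)) ⟩
  Vec.tabulate (lookup v′) ≡⟨ tabulate∘lookup v′ ⟩
  v′                       ∎
  where
  open ≡-Reasoning
  same-entries : ∀ i → toℕ (lookup v i) ≡ toℕ (lookup v′ i)
  same-entries i = trans (lookup-from-φ m n v i)
    (trans (cong (λ w → (+ toℕ (lookup w i) - + prefixSum w i) %ℕ m) φv≡φv′) (sym (lookup-from-φ m n v′ i)))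

_⊖[_]_ : ∀ {m} → Fin m → (m′ : ℕ) → .{{NonZero m}} → Fin m → Fin m
_⊖[_]_ {m} x _ a = (toℕ x + (m ∸ toℕ a)) mod m

⊕-⊖-cancel : ∀ {m} .{{_ : NonZero m}} (a x : Fin m) → a ⊕[ m ] (x ⊖[ m ] a) ≡ x
⊕-⊖-cancel {m} a x = toℕ-injective (begin
  toℕ (a ⊕[ m ] (x ⊖[ m ] a))                    ≡⟨ toℕ-⊕ a (x ⊖[ m ] a) ⟩
  (toℕ a + toℕ (x ⊖[ m ] a)) % m                  ≡⟨ cong (λ y → (toℕ a + y) % m) (toℕ-fromℕ< (m%n<n (toℕ x + (m ∸ toℕ a)) m)) ⟩
  (toℕ a + (toℕ x + (m ∸ toℕ a)) % m) % m         ≡⟨ [m+n%d]%d≡[m+n]%d (toℕ a) (toℕ x + (m ∸ toℕ a)) m ⟩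
  (toℕ a + (toℕ x + (m ∸ toℕ a))) % m             ≡⟨ cong (_% m) (x∙yz≈y∙xz (toℕ a) (toℕ x) (m ∸ toℕ a)) ⟩
  (toℕ x + (toℕ a + (m ∸ toℕ a))) % m             ≡⟨ cong (λ y → (toℕ x + y) % m) (m+[n∸m]≡n (<⇒≤ (toℕ<n a))) ⟩
  (toℕ x + m) % m                                 ≡⟨ [m+n]%n≡m%n (toℕ x) m ⟩
  toℕ x % m                                       ≡⟨ m<n⇒m%n≡m (toℕ<n x) ⟩
  toℕ x                                           ∎)
  where open ≡-Reasoning

φ-strictlySurjective : ∀ m .{{_ : NonZero m}} n → StrictlySurjective _≡_ (φ m n)
φ-strictlySurjective m zero [] = [] , refl
φ-strictlySurjective m (suc n) (a ∷ w) with φ-strictlySurjective m n w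
... | u , φu≡w = a ∷ map (_⊖[ m ] a) u , cong (a ∷_) (trans (cong (φ m n) shift-back) φu≡w)
  where
  shift-back : map (a ⊕[ m ]_) (map (_⊖[ m ] a) u) ≡ u
  shift-back = trans (sym (map-∘ (a ⊕[ m ]_) (_⊖[ m ] a) u)) (trans (map-cong (⊕-⊖-cancel a) u) (map-id u))

theorem4 : (m : ℕ) → .{{_ : NonZero m}} → 2 ≤ m → (n : ℕ) → 1 ≤ n →
    ((v : Vec (Fin m) n) → (i : Fin n) →
      toℕ (lookup v i) ≡ ((+ toℕ (lookup (φ m n v) i)) - (+ prefixSum (φ m n v) i)) %ℕ m)
    × Bijective _≡_ _≡_ (φ m n)
theorem4 m _ n _ = lookup-from-φ m n , φ-injective m n , strictlySurjective⇒surjective (φ-strictlySurjective m n)
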